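{- Let $\mathbf{v}=(v_1,\dots,v_r)\in\{+,-\}^r$ and let $A=\mathcal{G}(M)$ be a geometric grid class. Then the set product $\{\mathcal{G}^{\mathbf{v}}A\}$ equals the grid class $\mathcal{G}(M^{\mathbf{v}})$, where $M^{\mathbf{v}}$ is the matrix obtained by stacking $r$ copies of $M$ and $M^c$ on top of each other, the $i$-th copy from the bottom being $M$ if $v_i=+$ and $M^c$ if $v_i=-$.
   Context: Geometric grid classes: for a matrix $M$ with entries in $\{0,1,-1\}$, divide a rectangle into unit cells indexed by the entries of $M$ (row $i$ from the top, column $j$ from the left); in each cell with entry $1$ draw the segment joining its lower-left and upper-right corners, with entry $-1$ the segment joining its upper-left and lower-right corners. $\mathcal{G}_n(M)$ is the set of $\pi\in\mathfrak{S}_n$ obtained by placing $n$ points on these segments with no two sharing an $x$- or $y$-coordinate, labeling them $1,\dots,n$ by increasing $y$-coordinate and reading the labels by increasing $x$-coordinate; $\mathcal{G}(M)=\bigcup_{n\ge0}\mathcal{G}_n(M)$. For $\mathbf{v}\in\{+,-\}^r$, $\mathcal{G}^{\mathbf{v}}=\mathcal{G}(N)$ for the $r\times1$ matrix $N$ whose entries from bottom to top are $v_1,\dots,v_r$ ($+\mapsto1$, $-\mapsto-1$). $M^c$ is the matrix obtained by flipping $M$ upside down (reversing the order of its rows) and changing the signs of all entries. The product of permutations is composition, $(\pi\sigma)(i)=\pi(\sigma(i))$, taken for $\pi,\sigma$ in the same $\mathfrak{S}_n$, and $\{XY\}=\{\pi\sigma:\pi\in X\cap\mathfrak{S}_n,\sigma\in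 Y\cap\mathfrak{S}_n,n\ge0\}$ as a set.
   Formalization: The points placed on the segments that define each geometric grid class have rational coordinates. -}

module Defs where

open import Data.Nat using (ℕ; _*_)
open import Data.Fin using (Fin; toℕ)
open import Data.Fin.Permutation using (Permutation′; _⟨$⟩ʳ_)
import Data.Fin as F
open import Data.Integer using (+_)
open import Data.Rational using (ℚ; _/_; _+_; _-_; _≤_; _<_; 0ℚ; 1ℚ)
open import Data.Vec using (Vec; []; _∷_; lookup; map; reverse; concat)
open import Data.Product using (Σ; _×_; ∃; ∃-syntax; _,_)
open import Data.Sum using (_⊎_)
open import Relation.Binary.PropositionalEquality using (_≡_)
open import Function.Bundles using (_⇔_)

data Entry : Set where
  ezero epos eneg : Entry

data Sign : Set where
  plus minus : Sign

-- An m × k matrix, given as a vector of m rows (row 0 is the TOP row),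
-- each row a vector of k entries (column 0 is the LEFT column).
Matrix : ℕ → ℕ → Set
Matrix m k = Vec (Vec Entry k) m

negE : Entry → Entry
negE ezero = ezero
negE epos  = eneg
negE eneg  = epos

complement : ∀ {m k} → Matrix m k → Matrix m k
complement M = map (map negE) (reverse M)

ℕ→ℚ : ℕ → ℚ
ℕ→ℚ n = (+ n) / 1

-- The point (x , y) lies on the segment drawn in cell (i , j) of the
-- m × k matrix M.  Cell (i , j) is [j , j+1] × [m-1-i , m-i].
OnCell : ∀ {m k} → Matrix m k → Fin m → Fin k → ℚ → ℚ → Set
OnCell {m} M i j x y =
  Σ ℚ λ t → (0ℚ ≤ t) × (t ≤ 1ℚ) × (x ≡ ℕ→ℚ (toℕ j) + t) ×
    (  (lookup (lookup M i) j ≡ epos × y ≡ (ℕ→ℚ m - ℕ→ℚ (ℕ.suc (toℕ i))) + t)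
     ⊎ (lookup (lookup M i) j ≡ eneg × y ≡ (ℕ→ℚ m - ℕ→ℚ (toℕ i)) - t))
  where import Data.Nat as ℕ

OnGrid : ∀ {m k} → Matrix m k → ℚ → ℚ → Set
OnGrid M x y = ∃[ i ] ∃[ j ] OnCell M i j x y

-- π ∈ 𝒢_n(M): there are n points on the figure of M, indexed by their
-- position a in increasing x-order (x strictly increasing), with pairwise
-- distinct y-coordinates, such that the point at x-position a receives
-- label π(a) when points are labelled by increasing y-coordinate.
InGrid : ∀ {m k} → Matrix m k → (n : ℕ) → Permutation′ n → Set
InGrid M n π =
  Σ (Fin n → ℚ) λ xs → Σ (Fin n → ℚ) λ ys →
    (∀ a → OnGrid M (xs a) (ys a)) ×
    (∀ a b → a F.< b → xs a < xs b) ×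
    (∀ a b → ys a ≡ ys b → a ≡ b) ×
    (∀ a b → (π ⟨$⟩ʳ a F.< π ⟨$⟩ʳ b) ⇔ (ys a < ys b))

PermClass : Set₁
PermClass = (n : ℕ) → Permutation′ n → Set

𝒢 : ∀ {m k} → Matrix m k → PermClass
𝒢 M = InGrid M

-- Set product {X Y} = { π σ : π ∈ X ∩ 𝔖_n , σ ∈ Y ∩ 𝔖_n }, with
-- (π σ)(i) = π(σ(i)); τ belongs to it if it equals such a product pointwise.
SetProduct : PermClass → PermClass → PermClass
SetProduct X Y n τ =
  Σ (Permutation′ n) λ π → Σ (Permutation′ n) λ σ →
    X n π × Y n σ × (∀ i → τ ⟨$⟩ʳ i ≡ π ⟨$⟩ʳ (σ ⟨$⟩ʳ i))

_≐_ : PermClass → PermClass → Set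
X ≐ Y = ∀ n τ → X n τ ⇔ Y n τ

signEntry : Sign → Entry
signEntry plus  = epos
signEntry minus = eneg

-- 𝒢^v for v = (v₁ , … , v_r): the r × 1 matrix whose entries from bottom
-- to top are v₁ , … , v_r (so row 0, the top row, is v_r).
colMatrix : ∀ {r} → Vec Sign r → Matrix r 1
colMatrix v = reverse (map (λ s → signEntry s ∷ []) v)

𝒢ᵛ : ∀ {r} → Vec Sign r → PermClass
𝒢ᵛ v = 𝒢 (colMatrix v)

copyFor : ∀ {m k} → Matrix m k → Sign → Matrix m k
copyFor M plus  = M
copyFor M minus = complement M

-- M^v: r copies stacked, the i-th copy from the bottom being M if v_i = +
-- and M^c if v_i = -.  Rows are listed from the top, so the copies are
-- concatenated in the order v_r , … , v₁.
stackMatrix : ∀ {r m k} → Vec Sign r → Matrix m k → Matrix (r * m) k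
stackMatrix v M = concat (reverse (map (copyFor M) v))

-- The stacked matrix M^v is cut into r horizontal bands of height m, the s-th band from
-- the bottom holding a copy of M, reflected when v_s = −. A point of the stacked figure is
-- thus determined by its band s and its height y inside M, and the band structure is a
-- point of the column figure of G^v at height s + (y/m, reflected like the band). Ranking
-- the points by y gives σ ∈ G(M), the column points give π ∈ G^v, and τ = πσ; conversely a
-- product πσ is drawn by putting each point of σ, at its height inside M, into the band of
-- the column point of π it is sent to. Both constructions need general position: points
-- strictly inside their cells, so that neighbouring bands do not touch, and no two points at
-- the same height inside M even after reflection, so that the ranking is strict. This is
-- reached by moving each parameter t to ¼ + t/2 + ε_a, with distinct ε_a smaller than all
-- nonzero gaps, which keeps every strict comparison between points.

module Submission where

open import Defs
open import Data.Bool using (Bool; true; false; T)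
open import Data.Empty using (⊥; ⊥-elim)
open import Data.Fin as F using (Fin; toℕ; fromℕ<; punchOut)
import Data.Fin.Properties as F
open import Data.Fin.Permutation using (Permutation′; permutation; _⟨$⟩ʳ_; _⟨$⟩ˡ_; flip; _∘ₚ_; inverseˡ; inverseʳ)
open import Data.Integer as ℤ using (+_)
import Data.Integer.Properties as ℤ
open import Data.Nat as ℕ using (ℕ; zero; suc)
import Data.Nat.Properties as ℕ
open import Data.Nat.Coprimality using (1-coprimeTo)
import Data.Nat.Coprimality as Coprimality
open import Data.Product using (Σ; ∃; _×_; _,_; proj₁; proj₂)
open import Data.Rational
  using (ℚ; mkℚ; _/_; _+_; _-_; _*_; -_; _≤_; _<_; 0ℚ; 1ℚ; ½; _⊓_; *≤*; *<*; positive; nonNegative)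
open import Data.Rational.Properties
open import Data.Rational.Solver using (module +-*-Solver)
open import Data.Sum using (inj₁; inj₂)
open import Data.Unit using (tt)
open import Data.Vec using (Vec; []; _∷_; lookup; _∷ʳ_; reverse; map; concat)
import Data.Vec.Properties as Vec
open import Function using (_∘_)
open import Function.Bundles using (_⇔_; mk⇔; Equivalence)
import Function.Properties.Equivalence as ⇔
open import Relation.Binary using (tri<; tri≈; tri>)
open import Relation.Binary.PropositionalEquality
open import Relation.Nullary using (¬_; yes; no)
open import Relation.Nullary.Decidable using (isYes; toWitness; fromWitness)

open +-*-Solver

gap⇒≤ : ∀ {p q} d → q ≡ p + d → 0ℚ ≤ d → p ≤ q
gap⇒≤ {p} d refl 0≤d = subst (_≤ p + d) (+-identityʳ p) (+-monoʳ-≤ p 0≤d)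

gap⇒< : ∀ {p q} d → q ≡ p + d → 0ℚ < d → p < q
gap⇒< {p} d refl 0<d = subst (_< p + d) (+-identityʳ p) (+-monoʳ-< p 0<d)

p≤q⇒0≤q-p : ∀ {p q} → p ≤ q → 0ℚ ≤ q - p
p≤q⇒0≤q-p {p} {q} p≤q = subst (_≤ q - p) (+-inverseʳ p) (+-monoˡ-≤ (- p) p≤q)

p<q⇒0<q-p : ∀ {p q} → p < q → 0ℚ < q - p
p<q⇒0<q-p {p} {q} p<q = subst (_< q - p) (+-inverseʳ p) (+-monoˡ-< (- p) p<q)

0<q-p⇒p<q : ∀ {p q} → 0ℚ < q - p → p < q
0<q-p⇒p<q {p} {q} 0<q-p = gap⇒< (q - p) (solve 2 (λ p q → q := p :+ (q :- p)) refl p q) 0<q-p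

*-nonNeg : ∀ {p q} → 0ℚ ≤ p → 0ℚ ≤ q → 0ℚ ≤ p * q
*-nonNeg {p} {q} 0≤p 0≤q =
  nonNegative⁻¹ (p * q) {{nonNeg*nonNeg⇒nonNeg p {{nonNegative 0≤p}} q {{nonNegative 0≤q}}}}

*-pos : ∀ {p q} → 0ℚ < p → 0ℚ < q → 0ℚ < p * q
*-pos {p} {q} 0<p 0<q = positive⁻¹ (p * q) {{pos*pos⇒pos p {{positive 0<p}} q {{positive 0<q}}}}

neg-involutive : ∀ p → - (- p) ≡ p
neg-involutive = solve 1 (λ p → :- (:- p) := p) refl

-p+[p+q]≡q : ∀ p q → - p + (p + q) ≡ q
-p+[p+q]≡q = solve 2 (λ p q → :- p :+ (p :+ q) := q) refl

+-cancelˡ-≡ : ∀ r {p q} → r + p ≡ r + q → p ≡ q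
+-cancelˡ-≡ r {p} {q} e = trans (sym (-p+[p+q]≡q r p)) (trans (cong (λ z → - r + z) e) (-p+[p+q]≡q r q))

+-cancelˡ-< : ∀ r {p q} → r + p < r + q → p < q
+-cancelˡ-< r {p} {q} lt = subst₂ _<_ (-p+[p+q]≡q r p) (-p+[p+q]≡q r q) (+-monoʳ-< (- r) lt)

≤∧≢⇒< : ∀ {p q} → p ≤ q → p ≢ q → p < q
≤∧≢⇒< {p} {q} p≤q p≢q with <-cmp p q
... | tri< p<q _ _ = p<q
... | tri≈ _ p≡q _ = ⊥-elim (p≢q p≡q)
... | tri> _ _ q<p = ⊥-elim (<-irrefl refl (<-≤-trans q<p p≤q))

ℕ→ℚ-≡-mkℚ : ∀ n → ℕ→ℚ n ≡ mkℚ (+ n) 0 (Coprimality.sym (1-coprimeTo n))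
ℕ→ℚ-≡-mkℚ n = normalize-coprime (Coprimality.sym (1-coprimeTo n))

ℕ→ℚ-homo-+ : ∀ m n → ℕ→ℚ (m ℕ.+ n) ≡ ℕ→ℚ m + ℕ→ℚ n
ℕ→ℚ-homo-+ m n rewrite ℕ→ℚ-≡-mkℚ m | ℕ→ℚ-≡-mkℚ n =
  cong (_/ 1) (sym (cong₂ ℤ._+_ (ℤ.*-identityʳ (+ m)) (ℤ.*-identityʳ (+ n))))

ℕ→ℚ-homo-* : ∀ m n → ℕ→ℚ (m ℕ.* n) ≡ ℕ→ℚ m * ℕ→ℚ n
ℕ→ℚ-homo-* m n rewrite ℕ→ℚ-≡-mkℚ m | ℕ→ℚ-≡-mkℚ n = cong (_/ 1) (ℤ.pos-* m n)

ℕ→ℚ-suc : ∀ n → ℕ→ℚ (suc n) ≡ ℕ→ℚ n + 1ℚ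
ℕ→ℚ-suc n = trans (cong ℕ→ℚ (ℕ.+-comm 1 n)) (ℕ→ℚ-homo-+ n 1)

ℕ→ℚ-mono-≤ : ∀ {m n} → m ℕ.≤ n → ℕ→ℚ m ≤ ℕ→ℚ n
ℕ→ℚ-mono-≤ {m} {n} m≤n rewrite ℕ→ℚ-≡-mkℚ m | ℕ→ℚ-≡-mkℚ n =
  *≤* (subst₂ ℤ._≤_ (sym (ℤ.*-identityʳ (+ m))) (sym (ℤ.*-identityʳ (+ n))) (ℤ.+≤+ m≤n))

ℕ→ℚ-nonNeg : ∀ n → 0ℚ ≤ ℕ→ℚ n
ℕ→ℚ-nonNeg n = ℕ→ℚ-mono-≤ {0} {n} ℕ.z≤n

ℕ→ℚ-pos : ∀ n → 0ℚ < ℕ→ℚ (suc n)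
ℕ→ℚ-pos n rewrite ℕ→ℚ-≡-mkℚ (suc n) = *<* (ℤ.+<+ (ℕ.s≤s ℕ.z≤n))

ℕ→ℚ-<⇒+1≤ : ∀ {m n} → m ℕ.< n → ℕ→ℚ m + 1ℚ ≤ ℕ→ℚ n
ℕ→ℚ-<⇒+1≤ {m} m<n = subst (_≤ _) (ℕ→ℚ-suc m) (ℕ→ℚ-mono-≤ m<n)

-- Ranking by an injective key

count : ∀ {n} → (Fin n → Bool) → ℕ
count {zero}  p = 0
count {suc n} p with p F.zero
... | true  = suc (count (p ∘ F.suc))
... | false = count (p ∘ F.suc)

count-all : ∀ n → count {n} (λ _ → true) ≡ n
count-all zero    = refl
count-all (suc n) = cong suc (count-all n)

count-mono : ∀ {n} (p q : Fin n → Bool) → (∀ x → T (p x) → T (q x)) → count p ℕ.≤ count q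
count-mono {zero}  p q p⊆q = ℕ.z≤n
count-mono {suc n} p q p⊆q with p F.zero | q F.zero | p⊆q F.zero
... | true  | true  | _  = ℕ.s≤s (count-mono (p ∘ F.suc) (q ∘ F.suc) (p⊆q ∘ F.suc))
... | true  | false | p0⇒q0 = ⊥-elim (p0⇒q0 tt)
... | false | true  | _  = ℕ.m≤n⇒m≤1+n (count-mono (p ∘ F.suc) (q ∘ F.suc) (p⊆q ∘ F.suc))
... | false | false | _  = count-mono (p ∘ F.suc) (q ∘ F.suc) (p⊆q ∘ F.suc)

count-strictMono : ∀ {n} (p q : Fin n → Bool) → (∀ x → T (p x) → T (q x)) →
                   ∀ c → T (q c) → ¬ T (p c) → count p ℕ.< count q
count-strictMono {suc n} p q p⊆q F.zero qc ¬pc with p F.zero | q F.zero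
... | true  | _     = ⊥-elim (¬pc tt)
... | false | false = ⊥-elim qc
... | false | true  = ℕ.s≤s (count-mono (p ∘ F.suc) (q ∘ F.suc) (p⊆q ∘ F.suc))
count-strictMono {suc n} p q p⊆q (F.suc c) qc ¬pc with p F.zero | q F.zero | p⊆q F.zero
... | true  | true  | _  = ℕ.s≤s (count-strictMono (p ∘ F.suc) (q ∘ F.suc) (p⊆q ∘ F.suc) c qc ¬pc)
... | true  | false | p0⇒q0 = ⊥-elim (p0⇒q0 tt)
... | false | true  | _  = ℕ.m≤n⇒m≤1+n (count-strictMono (p ∘ F.suc) (q ∘ F.suc) (p⊆q ∘ F.suc) c qc ¬pc)
... | false | false | _  = count-strictMono (p ∘ F.suc) (q ∘ F.suc) (p⊆q ∘ F.suc) c qc ¬pc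

count<n : ∀ {n} (p : Fin n → Bool) c → ¬ T (p c) → count p ℕ.< n
count<n {n} p c ¬pc =
  subst (count p ℕ.<_) (count-all n) (count-strictMono p (λ _ → true) (λ _ _ → tt) c tt ¬pc)

injective⇒surjective : ∀ {n} (f : Fin n → Fin n) → (∀ a b → f a ≡ f b → a ≡ b) →
                       ∀ c → ∃ λ a → f a ≡ c
injective⇒surjective {suc n} f f-inj c with F.any? (λ a → f a F.≟ c)
... | yes hit = hit
... | no  miss = ⊥-elim (ℕ.<-irrefl refl (F.injective⇒≤ g-inj))
  where
  g : Fin (suc n) → Fin n
  g a = punchOut {i = c} (λ c≡fa → miss (a , sym c≡fa))
  g-inj : ∀ {a b} → g a ≡ g b → a ≡ b
  g-inj {a} {b} e = f-inj a b (F.punchOut-injective {i = c} _ _ e)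

module Ranking {n} (f : Fin n → ℚ) (f-injective : ∀ a b → f a ≡ f b → a ≡ b) where

  below : Fin n → Fin n → Bool
  below a b = isYes (f b <? f a)

  rank : Fin n → Fin n
  rank a = fromℕ< (count<n (below a) a (<-irrefl refl ∘ toWitness))

  rank-mono : ∀ a b → f a < f b → rank a F.< rank b
  rank-mono a b fa<fb = subst₂ ℕ._<_ (sym (F.toℕ-fromℕ< _)) (sym (F.toℕ-fromℕ< _))
    (count-strictMono (below a) (below b)
      (λ x x<a → fromWitness (<-trans (toWitness x<a) fa<fb)) a (fromWitness fa<fb)
      (<-irrefl refl ∘ toWitness))

  rank-injective : ∀ a b → rank a ≡ rank b → a ≡ b
  rank-injective a b e with <-cmp (f a) (f b)
  ... | tri< fa<fb _ _ = ⊥-elim (F.<-irrefl e (rank-mono a b fa<fb))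
  ... | tri≈ _ fa≡fb _ = f-injective a b fa≡fb
  ... | tri> _ _ fb<fa = ⊥-elim (F.<-irrefl (sym e) (rank-mono b a fb<fa))

  rank-cancel-< : ∀ a b → rank a F.< rank b → f a < f b
  rank-cancel-< a b ra<rb with <-cmp (f a) (f b)
  ... | tri< fa<fb _ _ = fa<fb
  ... | tri≈ _ fa≡fb _ rewrite f-injective a b fa≡fb = ⊥-elim (F.<-irrefl refl ra<rb)
  ... | tri> _ _ fb<fa = ⊥-elim (F.<-asym ra<rb (rank-mono b a fb<fa))

  opaque
    rankPermutation : Permutation′ n
    rankPermutation = permutation rank (proj₁ ∘ rank-onto) (proj₂ ∘ rank-onto)
      (λ a → rank-injective _ _ (proj₂ (rank-onto (rank a))))
      where
      rank-onto : ∀ c → ∃ λ a → rank a ≡ c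
      rank-onto = injective⇒surjective rank rank-injective

    rankPermutation-<⇔ : ∀ a b → (rankPermutation ⟨$⟩ʳ a F.< rankPermutation ⟨$⟩ʳ b) ⇔ (f a < f b)
    rankPermutation-<⇔ a b = mk⇔ (rank-cancel-< a b) (rank-mono a b)

height : Sign → ℚ → ℚ
height plus  t = t
height minus t = 1ℚ - t

1-t≤1 : ∀ {t} → 0ℚ ≤ t → 1ℚ - t ≤ 1ℚ
1-t≤1 {t} 0≤t = gap⇒≤ t (solve 1 (λ t → con 1ℚ := (con 1ℚ :- t) :+ t) refl t) 0≤t

1-t<1 : ∀ {t} → 0ℚ < t → 1ℚ - t < 1ℚ
1-t<1 {t} 0<t = gap⇒< t (solve 1 (λ t → con 1ℚ := (con 1ℚ :- t) :+ t) refl t) 0<t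

0≤height : ∀ s {t} → 0ℚ ≤ t → t ≤ 1ℚ → 0ℚ ≤ height s t
0≤height plus  0≤t _   = 0≤t
0≤height minus _   t≤1 = p≤q⇒0≤q-p t≤1

height≤1 : ∀ s {t} → 0ℚ ≤ t → t ≤ 1ℚ → height s t ≤ 1ℚ
height≤1 plus  _   t≤1 = t≤1
height≤1 minus 0≤t _   = 1-t≤1 0≤t

0<height : ∀ s {t} → 0ℚ < t → t < 1ℚ → 0ℚ < height s t
0<height plus  0<t _   = 0<t
0<height minus _   t<1 = p<q⇒0<q-p t<1

height<1 : ∀ s {t} → 0ℚ < t → t < 1ℚ → height s t < 1ℚ
height<1 plus  _   t<1 = t<1
height<1 minus 0<t _   = 1-t<1 0<t

-- The height of the bottom edge of row i; rows are numbered from the top.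
rowBase : ℕ → ℕ → ℚ
rowBase m i = ℕ→ℚ m - ℕ→ℚ (suc i)

record CellPoint {m k} (M : Matrix m k) (i : Fin m) (j : Fin k) (x y : ℚ) : Set where
  constructor cellPoint
  field
    t      : ℚ
    sign   : Sign
    0≤t    : 0ℚ ≤ t
    t≤1    : t ≤ 1ℚ
    x≡     : x ≡ ℕ→ℚ (toℕ j) + t
    entry≡ : lookup (lookup M i) j ≡ signEntry sign
    y≡     : y ≡ rowBase m (toℕ i) + height sign t

[m-i]-t≡rowBase+[1-t] : ∀ m i t → (ℕ→ℚ m - ℕ→ℚ i) - t ≡ rowBase m i + (1ℚ - t)
[m-i]-t≡rowBase+[1-t] m i t = begin
  (ℕ→ℚ m - ℕ→ℚ i) - t               ≡⟨ solve 3 (λ m i t → (m :- i) :- t := (m :- (i :+ con 1ℚ)) :+ (con 1ℚ :- t))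
                                               refl (ℕ→ℚ m) (ℕ→ℚ i) t ⟩
  (ℕ→ℚ m - (ℕ→ℚ i + 1ℚ)) + (1ℚ - t) ≡⟨ cong (λ z → (ℕ→ℚ m - z) + (1ℚ - t)) (ℕ→ℚ-suc i) ⟨
  rowBase m i + (1ℚ - t)            ∎
  where open ≡-Reasoning

fromOnCell : ∀ {m k} {M : Matrix m k} {i j x y} → OnCell M i j x y → CellPoint M i j x y
fromOnCell (t , 0≤t , t≤1 , x≡ , inj₁ (entry≡ , y≡)) = cellPoint t plus 0≤t t≤1 x≡ entry≡ y≡
fromOnCell {m} {i = i} (t , 0≤t , t≤1 , x≡ , inj₂ (entry≡ , y≡)) =
  cellPoint t minus 0≤t t≤1 x≡ entry≡ (trans y≡ ([m-i]-t≡rowBase+[1-t] m (toℕ i) t))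

toOnCell : ∀ {m k} {M : Matrix m k} {i j x y} → CellPoint M i j x y → OnCell M i j x y
toOnCell (cellPoint t plus 0≤t t≤1 x≡ entry≡ y≡) = t , 0≤t , t≤1 , x≡ , inj₁ (entry≡ , y≡)
toOnCell {m} {i = i} (cellPoint t minus 0≤t t≤1 x≡ entry≡ y≡) =
  t , 0≤t , t≤1 , x≡ , inj₂ (entry≡ , trans y≡ (sym ([m-i]-t≡rowBase+[1-t] m (toℕ i) t)))

record Placement {m k} (M : Matrix m k) (n : ℕ) (π : Permutation′ n) : Set where
  field
    x y          : Fin n → ℚ
    row          : Fin n → Fin m
    col          : Fin n → Fin k
    onCell       : ∀ a → CellPoint M (row a) (col a) (x a) (y a)
    x-increasing : ∀ a b → a F.< b → x a < x b
    y-injective  : ∀ a b → y a ≡ y b → a ≡ b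
    y-order      : ∀ a b → (π ⟨$⟩ʳ a F.< π ⟨$⟩ʳ b) ⇔ (y a < y b)

  t : Fin n → ℚ
  t a = CellPoint.t (onCell a)

  sign : Fin n → Sign
  sign a = CellPoint.sign (onCell a)

fromInGrid : ∀ {m k} {M : Matrix m k} {n π} → InGrid M n π → Placement M n π
fromInGrid (x , y , onGrid , x-inc , y-inj , y-ord) = record
  { x = x ; y = y ; row = proj₁ ∘ onGrid ; col = proj₁ ∘ proj₂ ∘ onGrid
  ; onCell = λ a → fromOnCell (proj₂ (proj₂ (onGrid a)))
  ; x-increasing = x-inc ; y-injective = y-inj ; y-order = y-ord }

toInGrid : ∀ {m k} {M : Matrix m k} {n π} → Placement M n π → InGrid M n π
toInGrid P = x , y , (λ a → row a , col a , toOnCell (onCell a)) , x-increasing , y-injective , y-order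
  where open Placement P

data UnitSpaced (A B : ℚ) : Set where
  same   : A ≡ B → UnitSpaced A B
  lower  : A + 1ℚ ≤ B → UnitSpaced A B
  higher : B + 1ℚ ≤ A → UnitSpaced A B

unitSpaced-<-transfer : ∀ {A B u v u′ v′} → UnitSpaced A B →
  0ℚ ≤ u → v ≤ 1ℚ → u′ < 1ℚ → 0ℚ ≤ v′ →
  A + u < B + v → (u < v → u′ < v′) → A + u′ < B + v′
unitSpaced-<-transfer {A} (same refl) _ _ _ _ lt transfer = +-monoʳ-< A (transfer (+-cancelˡ-< A lt))
unitSpaced-<-transfer {A} {B} (lower A+1≤B) _ _ u′<1 0≤v′ _ _ =
  <-≤-trans (+-monoʳ-< A u′<1) (≤-trans A+1≤B (gap⇒≤ _ refl 0≤v′))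
unitSpaced-<-transfer {A} {B} (higher B+1≤A) 0≤u v≤1 _ _ lt _ = ⊥-elim (<-irrefl refl
  (<-≤-trans lt (≤-trans (+-monoʳ-≤ B v≤1) (≤-trans B+1≤A (gap⇒≤ _ refl 0≤u)))))

unitSpaced-≡ : ∀ {A B u v} → UnitSpaced A B → 0ℚ ≤ u → u < 1ℚ → 0ℚ ≤ v → v < 1ℚ →
  A + u ≡ B + v → u ≡ v
unitSpaced-≡ {A} (same refl) _ _ _ _ e = +-cancelˡ-≡ A e
unitSpaced-≡ {A} {B} (lower A+1≤B) _ u<1 0≤v _ e =
  ⊥-elim (<-irrefl e (<-≤-trans (+-monoʳ-< A u<1) (≤-trans A+1≤B (gap⇒≤ _ refl 0≤v))))
unitSpaced-≡ {A} {B} (higher B+1≤A) 0≤u _ _ v<1 e =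
  ⊥-elim (<-irrefl (sym e) (<-≤-trans (+-monoʳ-< B v<1) (≤-trans B+1≤A (gap⇒≤ _ refl 0≤u))))

ℕ→ℚ-unitSpaced : ∀ j j′ → UnitSpaced (ℕ→ℚ j) (ℕ→ℚ j′)
ℕ→ℚ-unitSpaced j j′ with ℕ.<-cmp j j′
... | tri< j<j′ _ _ = lower (ℕ→ℚ-<⇒+1≤ j<j′)
... | tri≈ _ refl _ = same refl
... | tri> _ _ j′<j = higher (ℕ→ℚ-<⇒+1≤ j′<j)

rowBase-step : ∀ m {i i′} → i ℕ.< i′ → rowBase m i′ + 1ℚ ≤ rowBase m i
rowBase-step m {i} {i′} i<i′ = gap⇒≤ _
  (solve 3 (λ m i i′ → m :- i := ((m :- i′) :+ con 1ℚ) :+ (i′ :- (i :+ con 1ℚ))) refl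
    (ℕ→ℚ m) (ℕ→ℚ (suc i)) (ℕ→ℚ (suc i′)))
  (p≤q⇒0≤q-p (ℕ→ℚ-<⇒+1≤ (ℕ.s≤s i<i′)))

rowBase-unitSpaced : ∀ m i i′ → UnitSpaced (rowBase m i) (rowBase m i′)
rowBase-unitSpaced m i i′ with ℕ.<-cmp i i′
... | tri< i<i′ _ _ = higher (rowBase-step m i<i′)
... | tri≈ _ refl _ = same refl
... | tri> _ _ i′<i = lower (rowBase-step m i′<i)

-- General position

¼ ⅛ 8ℚ : ℚ
¼  = + 1 / 4
⅛  = + 1 / 8
8ℚ = + 8 / 1

0<¼ : 0ℚ < ¼
0<¼ = *<* (ℤ.+<+ (ℕ.s≤s ℕ.z≤n))

0<⅛ : 0ℚ < ⅛
0<⅛ = *<* (ℤ.+<+ (ℕ.s≤s ℕ.z≤n))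

0<½ : 0ℚ < ½
0<½ = *<* (ℤ.+<+ (ℕ.s≤s ℕ.z≤n))

0<8ℚ : 0ℚ < 8ℚ
0<8ℚ = *<* (ℤ.+<+ (ℕ.s≤s ℕ.z≤n))

0<1ℚ : 0ℚ < 1ℚ
0<1ℚ = *<* (ℤ.+<+ (ℕ.s≤s ℕ.z≤n))

-- The factor 8 leaves room: after halving, a gap of 4δ still beats two shifts of size δ.
data Separated (δ d : ℚ) : Set where
  nil   : d ≡ 0ℚ → Separated δ d
  above : 8ℚ * δ ≤ d → Separated δ d
  below : 8ℚ * δ ≤ - d → Separated δ d

separated-neg : ∀ {δ d} → Separated δ d → Separated δ (- d)
separated-neg (nil refl) = nil refl
separated-neg {δ} {d} (above 8δ≤d) = below (subst (8ℚ * δ ≤_) (sym (neg-involutive d)) 8δ≤d)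
separated-neg (below 8δ≤-d) = above 8δ≤-d

separated-height : ∀ {δ} (s s′ : Sign) (u v : ℚ) → Separated δ (v - u) → Separated δ ((u + v) - 1ℚ) →
                   Separated δ (height s′ v - height s u)
separated-height plus  plus  u v sep-diff sep-sum = sep-diff
separated-height minus minus u v sep-diff sep-sum =
  subst (Separated _) (solve 2 (λ u v → :- (v :- u) := (con 1ℚ :- v) :- (con 1ℚ :- u)) refl u v) (separated-neg sep-diff)
separated-height plus  minus u v sep-diff sep-sum =
  subst (Separated _) (solve 2 (λ u v → :- ((u :+ v) :- con 1ℚ) := (con 1ℚ :- v) :- u) refl u v) (separated-neg sep-sum)
separated-height minus plus  u v sep-diff sep-sum =
  subst (Separated _) (solve 2 (λ u v → (u :+ v) :- con 1ℚ := v :- (con 1ℚ :- u)) refl u v) sep-sum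

record Small (δ ρ : ℚ) : Set where
  constructor small
  field
    -δ≤ρ : - δ ≤ ρ
    ρ≤δ  : ρ ≤ δ

signed : Sign → ℚ → ℚ
signed plus  e = e
signed minus e = - e

signed-small : ∀ s {δ e} → 0ℚ ≤ e → e ≤ δ → Small δ (signed s e)
signed-small plus  0≤e e≤δ = small (≤-trans (neg-antimono-≤ (≤-trans 0≤e e≤δ)) 0≤e) e≤δ
signed-small minus 0≤e e≤δ = small (neg-antimono-≤ e≤δ) (≤-trans (neg-antimono-≤ 0≤e) (≤-trans 0≤e e≤δ))

signed-injective : ∀ s s′ {e e′} → 0ℚ < e → 0ℚ < e′ → signed s e ≡ signed s′ e′ → e ≡ e′
signed-injective plus  plus  _ _ e≡e′ = e≡e′
signed-injective minus minus _ _ e≡e′ = neg-injective e≡e′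
signed-injective plus  minus 0<e 0<e′ e≡-e′ =
  ⊥-elim (<-asym 0<e (subst (_< 0ℚ) (sym e≡-e′) (neg-antimono-< 0<e′)))
signed-injective minus plus  0<e 0<e′ -e≡e′ =
  ⊥-elim (<-asym 0<e′ (subst (_< 0ℚ) -e≡e′ (neg-antimono-< 0<e)))

-- Shrinks [0,1] onto [¼,¾], moving points off the cell borders, then shifts by ρ.
nudge : ℚ → ℚ → ℚ
nudge u ρ = ¼ + u * ½ + ρ

height-nudge : ∀ s u e → height s (nudge u e) ≡ nudge (height s u) (signed s e)
height-nudge plus  u e = refl
height-nudge minus u e =
  solve 2 (λ u e → con 1ℚ :- (con ¼ :+ u :* con ½ :+ e) := con ¼ :+ (con 1ℚ :- u) :* con ½ :+ (:- e)) refl u e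

nudge-<-of-gap : ∀ {δ u v ρ ρ′} → 0ℚ < δ → 8ℚ * δ ≤ v - u → Small δ ρ → Small δ ρ′ → nudge u ρ < nudge v ρ′
nudge-<-of-gap {δ} {u} {v} {ρ} {ρ′} 0<δ 8δ≤v-u (small _ ρ≤δ) (small -δ≤ρ′ _) = gap⇒< _
  (solve 5 (λ u v ρ ρ′ δ → con ¼ :+ v :* con ½ :+ ρ′ :=
      (con ¼ :+ u :* con ½ :+ ρ) :+ ((((v :- u) :- con 8ℚ :* δ) :* con ½ :+ (ρ′ :- (:- δ))) :+ ((δ :- ρ) :+ (δ :+ δ))))
    refl u v ρ ρ′ δ)
  (+-mono-≤-< (+-mono-≤ (*-nonNeg (p≤q⇒0≤q-p 8δ≤v-u) (<⇒≤ 0<½)) (p≤q⇒0≤q-p -δ≤ρ′))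
              (+-mono-≤-< (p≤q⇒0≤q-p ρ≤δ) (+-mono-< 0<δ 0<δ)))

8δ≤d⇒0<d : ∀ {δ d} → 0ℚ < δ → 8ℚ * δ ≤ d → 0ℚ < d
8δ≤d⇒0<d 0<δ 8δ≤d = <-≤-trans (*-pos 0<8ℚ 0<δ) 8δ≤d

-[v-u]≡u-v : ∀ u v → - (v - u) ≡ u - v
-[v-u]≡u-v = solve 2 (λ u v → :- (v :- u) := u :- v) refl

nudge-< : ∀ {δ u v ρ ρ′} → 0ℚ < δ → Separated δ (v - u) → u < v → Small δ ρ → Small δ ρ′ →
          nudge u ρ < nudge v ρ′
nudge-< _ (nil v-u≡0) u<v _ _ = ⊥-elim (<-irrefl (sym v-u≡0) (p<q⇒0<q-p u<v))
nudge-< {u = u} {v} 0<δ (below 8δ≤-[v-u]) u<v _ _ =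
  ⊥-elim (<-asym u<v (0<q-p⇒p<q (subst (0ℚ <_) (-[v-u]≡u-v u v) (8δ≤d⇒0<d 0<δ 8δ≤-[v-u]))))
nudge-< {u = u} {v} 0<δ (above 8δ≤v-u) _ small-ρ small-ρ′ = nudge-<-of-gap {u = u} {v} 0<δ 8δ≤v-u small-ρ small-ρ′

nudge-injective : ∀ {δ u v ρ ρ′} → 0ℚ < δ → Separated δ (v - u) → Small δ ρ → Small δ ρ′ →
                  nudge u ρ ≡ nudge v ρ′ → ρ ≡ ρ′
nudge-injective {u = u} {v} {ρ} {ρ′} _ (nil v-u≡0) _ _ e =
  +-cancelˡ-≡ (¼ + u * ½) (trans e (cong (λ w → ¼ + w * ½ + ρ′) (sym u≡v)))
  where
  u≡v : u ≡ v
  u≡v = sym (trans (solve 2 (λ u v → v := u :+ (v :- u)) refl u v) (trans (cong (λ w → u + w) v-u≡0) (+-identityʳ u)))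
nudge-injective {u = u} {v} 0<δ (above 8δ≤v-u) small-ρ small-ρ′ e =
  ⊥-elim (<-irrefl e (nudge-<-of-gap {u = u} {v} 0<δ 8δ≤v-u small-ρ small-ρ′))
nudge-injective {δ} {u} {v} 0<δ (below 8δ≤-[v-u]) small-ρ small-ρ′ e =
  ⊥-elim (<-irrefl (sym e) (nudge-<-of-gap {u = v} {u} 0<δ (subst (8ℚ * δ ≤_) (-[v-u]≡u-v u v) 8δ≤-[v-u]) small-ρ′ small-ρ))

-- Never above 1, the value on the empty family; this is what gives δ ≤ ⅛.
minimum : ∀ {n} → (Fin n → ℚ) → ℚ
minimum {zero}  f = 1ℚ
minimum {suc n} f = f F.zero ⊓ minimum (f ∘ F.suc)

minimum≤ : ∀ {n} (f : Fin n → ℚ) a → minimum f ≤ f a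
minimum≤ f F.zero    = p⊓q≤p (f F.zero) _
minimum≤ f (F.suc a) = ≤-trans (p⊓q≤q (f F.zero) _) (minimum≤ (f ∘ F.suc) a)

minimum≤1 : ∀ {n} (f : Fin n → ℚ) → minimum f ≤ 1ℚ
minimum≤1 {zero}  f = ≤-refl
minimum≤1 {suc n} f = ≤-trans (p⊓q≤q (f F.zero) _) (minimum≤1 (f ∘ F.suc))

minimum-pos : ∀ {n} (f : Fin n → ℚ) → (∀ a → 0ℚ < f a) → 0ℚ < minimum f
minimum-pos {zero}  f _ = 0<1ℚ
minimum-pos {suc n} f f-pos with ⊓-sel (f F.zero) (minimum (f ∘ F.suc))
... | inj₁ e = subst (0ℚ <_) (sym e) (f-pos F.zero)
... | inj₂ e = subst (0ℚ <_) (sym e) (minimum-pos (f ∘ F.suc) (f-pos ∘ F.suc))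

-- The value 1 at d = 0 is arbitrary: a zero gap imposes no constraint.
gapSize : ℚ → ℚ
gapSize d with <-cmp d 0ℚ
... | tri< _ _ _ = - d
... | tri≈ _ _ _ = 1ℚ
... | tri> _ _ _ = d

gapSize-pos : ∀ d → 0ℚ < gapSize d
gapSize-pos d with <-cmp d 0ℚ
... | tri< d<0 _ _ = neg-antimono-< d<0
... | tri≈ _ _ _   = 0<1ℚ
... | tri> _ _ 0<d = 0<d

gapSize-separated : ∀ δ d → 8ℚ * δ ≤ gapSize d → Separated δ d
gapSize-separated δ d 8δ≤gap with <-cmp d 0ℚ
... | tri< _ _ _   = below 8δ≤gap
... | tri≈ _ d≡0 _ = nil d≡0
... | tri> _ _ _   = above 8δ≤gap

-- 1/(k+1): mkℚ stores the denominator minus one.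
unitFraction : ℕ → ℚ
unitFraction k = mkℚ (+ 1) k (1-coprimeTo (suc k))

unitFraction-pos : ∀ k → 0ℚ < unitFraction k
unitFraction-pos k = *<* (ℤ.+<+ (ℕ.s≤s ℕ.z≤n))

unitFraction≤1 : ∀ k → unitFraction k ≤ 1ℚ
unitFraction≤1 k = *≤* (ℤ.+≤+ (ℕ.s≤s ℕ.z≤n))

unitFraction-injective : ∀ {k l} → unitFraction k ≡ unitFraction l → k ≡ l
unitFraction-injective = cong ℚ.denominator-1

module Perturbation {n} (t : Fin n → ℚ) (0≤t : ∀ a → 0ℚ ≤ t a) (t≤1 : ∀ a → t a ≤ 1ℚ) where

  minGap : Fin n → Fin n → ℚ
  minGap a b = gapSize (t b - t a) ⊓ gapSize ((t a + t b) - 1ℚ)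

  minGapFrom : Fin n → ℚ
  minGapFrom a = minimum (minGap a)

  Δ δ : ℚ
  Δ = minimum minGapFrom
  δ = Δ * ⅛

  0<δ : 0ℚ < δ
  0<δ = *-pos (minimum-pos minGapFrom (λ a → minimum-pos (minGap a) (min-pos a))) 0<⅛
    where
    min-pos : ∀ a b → 0ℚ < minGap a b
    min-pos a b with ⊓-sel (gapSize (t b - t a)) (gapSize ((t a + t b) - 1ℚ))
    ... | inj₁ e = subst (0ℚ <_) (sym e) (gapSize-pos (t b - t a))
    ... | inj₂ e = subst (0ℚ <_) (sym e) (gapSize-pos ((t a + t b) - 1ℚ))

  δ≤⅛ : δ ≤ ⅛
  δ≤⅛ = gap⇒≤ ((1ℚ - Δ) * ⅛) (solve 1 (λ Δ → con ⅛ := Δ :* con ⅛ :+ (con 1ℚ :- Δ) :* con ⅛) refl Δ)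
    (*-nonNeg (p≤q⇒0≤q-p (minimum≤1 minGapFrom)) (<⇒≤ 0<⅛))

  8δ≤minGap : ∀ a b → 8ℚ * δ ≤ minGap a b
  8δ≤minGap a b = subst (_≤ minGap a b) (solve 1 (λ Δ → Δ := con 8ℚ :* (Δ :* con ⅛)) refl Δ)
    (≤-trans (minimum≤ minGapFrom a) (minimum≤ (minGap a) b))

  separated-diff : ∀ a b → Separated δ (t b - t a)
  separated-diff a b = gapSize-separated δ _ (≤-trans (8δ≤minGap a b) (p⊓q≤p (gapSize (t b - t a)) _))

  separated-sum : ∀ a b → Separated δ ((t a + t b) - 1ℚ)
  separated-sum a b = gapSize-separated δ _ (≤-trans (8δ≤minGap a b) (p⊓q≤q (gapSize (t b - t a)) _))

  ε : Fin n → ℚ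
  ε a = δ * unitFraction (toℕ a)

  0<ε : ∀ a → 0ℚ < ε a
  0<ε a = *-pos 0<δ (unitFraction-pos _)

  ε≤δ : ∀ a → ε a ≤ δ
  ε≤δ a = subst (ε a ≤_) (*-identityʳ δ)
    (*-monoˡ-≤-nonNeg δ {{nonNegative (<⇒≤ 0<δ)}} (unitFraction≤1 _))

  ε-injective : ∀ a b → ε a ≡ ε b → a ≡ b
  ε-injective a b e = F.toℕ-injective (unitFraction-injective (≤-antisym
    (*-cancelˡ-≤-pos δ {{positive 0<δ}} (≤-reflexive e))
    (*-cancelˡ-≤-pos δ {{positive 0<δ}} (≤-reflexive (sym e)))))

  t′ : Fin n → ℚ
  t′ a = nudge (t a) (ε a)

  0<t′ : ∀ a → 0ℚ < t′ a
  0<t′ a = +-mono-≤-< (+-mono-≤ (<⇒≤ 0<¼) (*-nonNeg (0≤t a) (<⇒≤ 0<½))) (0<ε a)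

  t′<1 : ∀ a → t′ a < 1ℚ
  t′<1 a = gap⇒< _
    (solve 3 (λ t ε δ → con 1ℚ := (con ¼ :+ t :* con ½ :+ ε) :+ ((con 1ℚ :- t) :* con ½ :+ ((con ⅛ :- δ) :+ ((δ :- ε) :+ con ⅛))))
       refl (t a) (ε a) δ)
    (+-mono-≤-< (*-nonNeg (p≤q⇒0≤q-p (t≤1 a)) (<⇒≤ 0<½))
      (+-mono-≤-< (p≤q⇒0≤q-p δ≤⅛) (+-mono-≤-< (p≤q⇒0≤q-p (ε≤δ a)) 0<⅛)))

  small-ε : ∀ s a → Small δ (signed s (ε a))
  small-ε s a = signed-small s (<⇒≤ (0<ε a)) (ε≤δ a)

  separated-height-t : ∀ s s′ a b → Separated δ (height s′ (t b) - height s (t a))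
  separated-height-t s s′ a b = separated-height s s′ (t a) (t b) (separated-diff a b) (separated-sum a b)

  height-t′-< : ∀ s s′ {a b} → height s (t a) < height s′ (t b) → height s (t′ a) < height s′ (t′ b)
  height-t′-< s s′ {a} {b} lt = subst₂ _<_ (sym (height-nudge s (t a) (ε a))) (sym (height-nudge s′ (t b) (ε b)))
    (nudge-< 0<δ (separated-height-t s s′ a b) lt (small-ε s a) (small-ε s′ b))

  height-t′-injective : ∀ s s′ a b → height s (t′ a) ≡ height s′ (t′ b) → a ≡ b
  height-t′-injective s s′ a b e = ε-injective a b (signed-injective s s′ (0<ε a) (0<ε b)
    (nudge-injective {u = height s (t a)} {height s′ (t b)} 0<δ (separated-height-t s s′ a b) (small-ε s a) (small-ε s′ b)
      (trans (sym (height-nudge s (t a) (ε a))) (trans e (height-nudge s′ (t b) (ε b))))))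

record GeneralPosition {m k} {M : Matrix m k} {n π} (P : Placement M n π) : Set where
  open Placement P
  field
    0<t              : ∀ a → 0ℚ < t a
    t<1              : ∀ a → t a < 1ℚ
    height-injective : ∀ s s′ a b → height s (t a) ≡ height s′ (t b) → a ≡ b

module Perturbed {m k} {M : Matrix m k} {n π} (P : Placement M n π) where
  open Placement P
  open Perturbation t (CellPoint.0≤t ∘ onCell) (CellPoint.t≤1 ∘ onCell)

  x′ y′ : Fin n → ℚ
  x′ a = ℕ→ℚ (toℕ (col a)) + t′ a
  y′ a = rowBase m (toℕ (row a)) + height (sign a) (t′ a)

  0≤height-t : ∀ a → 0ℚ ≤ height (sign a) (t a)
  0≤height-t a = 0≤height (sign a) (CellPoint.0≤t (onCell a)) (CellPoint.t≤1 (onCell a))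

  height-t≤1 : ∀ a → height (sign a) (t a) ≤ 1ℚ
  height-t≤1 a = height≤1 (sign a) (CellPoint.0≤t (onCell a)) (CellPoint.t≤1 (onCell a))

  0<height-t′ : ∀ a → 0ℚ < height (sign a) (t′ a)
  0<height-t′ a = 0<height (sign a) (0<t′ a) (t′<1 a)

  height-t′<1 : ∀ a → height (sign a) (t′ a) < 1ℚ
  height-t′<1 a = height<1 (sign a) (0<t′ a) (t′<1 a)

  x′-increasing : ∀ a b → a F.< b → x′ a < x′ b
  x′-increasing a b a<b = unitSpaced-<-transfer (ℕ→ℚ-unitSpaced (toℕ (col a)) (toℕ (col b)))
    (CellPoint.0≤t (onCell a)) (CellPoint.t≤1 (onCell b)) (t′<1 a) (<⇒≤ (0<t′ b))
    (subst₂ _<_ (CellPoint.x≡ (onCell a)) (CellPoint.x≡ (onCell b)) (x-increasing a b a<b))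
    (height-t′-< plus plus)

  y′-mono : ∀ a b → y a < y b → y′ a < y′ b
  y′-mono a b ya<yb = unitSpaced-<-transfer (rowBase-unitSpaced m (toℕ (row a)) (toℕ (row b)))
    (0≤height-t a) (height-t≤1 b) (height-t′<1 a) (<⇒≤ (0<height-t′ b))
    (subst₂ _<_ (CellPoint.y≡ (onCell a)) (CellPoint.y≡ (onCell b)) ya<yb)
    (height-t′-< (sign a) (sign b))

  y′-injective : ∀ a b → y′ a ≡ y′ b → a ≡ b
  y′-injective a b e = height-t′-injective (sign a) (sign b) a b
    (unitSpaced-≡ (rowBase-unitSpaced m (toℕ (row a)) (toℕ (row b)))
      (<⇒≤ (0<height-t′ a)) (height-t′<1 a) (<⇒≤ (0<height-t′ b)) (height-t′<1 b) e)

  y′-cancel-< : ∀ a b → y′ a < y′ b → y a < y b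
  y′-cancel-< a b y′a<y′b with <-cmp (y a) (y b)
  ... | tri< ya<yb _ _ = ya<yb
  ... | tri≈ _ ya≡yb _ rewrite y-injective a b ya≡yb = ⊥-elim (<-irrefl refl y′a<y′b)
  ... | tri> _ _ yb<ya = ⊥-elim (<-asym y′a<y′b (y′-mono b a yb<ya))

  placement : Placement M n π
  placement = record
    { x = x′ ; y = y′ ; row = row ; col = col
    ; onCell = λ a → cellPoint (t′ a) (sign a) (<⇒≤ (0<t′ a)) (<⇒≤ (t′<1 a)) refl (CellPoint.entry≡ (onCell a)) refl
    ; x-increasing = x′-increasing ; y-injective = y′-injective
    ; y-order = λ a b → mk⇔ (y′-mono a b ∘ Equivalence.to (y-order a b)) (Equivalence.from (y-order a b) ∘ y′-cancel-< a b) }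

  generalPosition : GeneralPosition placement
  generalPosition = record { 0<t = 0<t′ ; t<1 = t′<1 ; height-injective = height-t′-injective }

opaque
  toGeneralPosition : ∀ {m k} {M : Matrix m k} {n π} → Placement M n π → Σ (Placement M n π) GeneralPosition
  toGeneralPosition P = Perturbed.placement P , Perturbed.generalPosition P

lookup-∷ʳ-last : ∀ {A : Set} {n} (xs : Vec A n) x → lookup (xs ∷ʳ x) (F.fromℕ n) ≡ x
lookup-∷ʳ-last []       x = refl
lookup-∷ʳ-last (_ ∷ xs) x = lookup-∷ʳ-last xs x

lookup-∷ʳ-inject₁ : ∀ {A : Set} {n} (xs : Vec A n) x i → lookup (xs ∷ʳ x) (F.inject₁ i) ≡ lookup xs i
lookup-∷ʳ-inject₁ (_ ∷ xs) x F.zero    = refl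
lookup-∷ʳ-inject₁ (_ ∷ xs) x (F.suc i) = lookup-∷ʳ-inject₁ xs x i

lookup-reverse-opposite : ∀ {A : Set} {n} (xs : Vec A n) i → lookup (reverse xs) (F.opposite i) ≡ lookup xs i
lookup-reverse-opposite (x ∷ xs) F.zero rewrite Vec.reverse-∷ x xs = lookup-∷ʳ-last (reverse xs) x
lookup-reverse-opposite (x ∷ xs) (F.suc i) rewrite Vec.reverse-∷ x xs =
  trans (lookup-∷ʳ-inject₁ (reverse xs) x (F.opposite i)) (lookup-reverse-opposite xs i)

lookup-reverse : ∀ {A : Set} {n} (xs : Vec A n) i → lookup (reverse xs) i ≡ lookup xs (F.opposite i)
lookup-reverse xs i =
  trans (cong (lookup (reverse xs)) (sym (F.opposite-involutive i))) (lookup-reverse-opposite xs (F.opposite i))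

signEntry-injective : ∀ {s s′} → signEntry s ≡ signEntry s′ → s ≡ s′
signEntry-injective {plus}  {plus}  _ = refl
signEntry-injective {minus} {minus} _ = refl

negSign : Sign → Sign
negSign plus  = minus
negSign minus = plus

negE-signEntry : ∀ s → negE (signEntry s) ≡ signEntry (negSign s)
negE-signEntry plus  = refl
negE-signEntry minus = refl

negE-involutive : ∀ e → negE (negE e) ≡ e
negE-involutive ezero = refl
negE-involutive epos  = refl
negE-involutive eneg  = refl

height-negSign : ∀ s t → height (negSign s) t ≡ 1ℚ - height s t
height-negSign plus  t = refl
height-negSign minus t = solve 1 (λ t → t := con 1ℚ :- (con 1ℚ :- t)) refl t

ℕ→ℚ-opposite : ∀ {r} (q : Fin r) → ℕ→ℚ r ≡ ℕ→ℚ (toℕ (F.opposite q)) + ℕ→ℚ (suc (toℕ q))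
ℕ→ℚ-opposite {r} q = trans (cong ℕ→ℚ r≡opp+suc) (ℕ→ℚ-homo-+ (toℕ (F.opposite q)) (suc (toℕ q)))
  where
  r≡opp+suc : r ≡ toℕ (F.opposite q) ℕ.+ suc (toℕ q)
  r≡opp+suc = sym (trans (cong (ℕ._+ suc (toℕ q)) (F.opposite-prop q)) (ℕ.m∸n+n≡m (F.toℕ<n q)))

rowBase-opposite : ∀ {r} (q : Fin r) → rowBase r (toℕ q) ≡ ℕ→ℚ (toℕ (F.opposite q))
rowBase-opposite {r} q = trans (cong (_- ℕ→ℚ (suc (toℕ q))) (ℕ→ℚ-opposite q))
  (solve 2 (λ a b → (a :+ b) :- b := a) refl (ℕ→ℚ (toℕ (F.opposite q))) (ℕ→ℚ (suc (toℕ q))))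

rowBase-opposite-opposite : ∀ {m} (i : Fin m) → rowBase m (toℕ (F.opposite i)) ≡ ℕ→ℚ (toℕ i)
rowBase-opposite-opposite i = trans (rowBase-opposite (F.opposite i)) (cong (ℕ→ℚ ∘ toℕ) (F.opposite-involutive i))

reflect-height : ∀ m (i : Fin m) s t →
  rowBase m (toℕ i) + height s t ≡ ℕ→ℚ m - (rowBase m (toℕ (F.opposite i)) + height (negSign s) t)
reflect-height m i s t = begin
  (ℕ→ℚ m - ℕ→ℚ (suc (toℕ i))) + height s t                      ≡⟨ cong (λ z → (ℕ→ℚ m - z) + height s t) (ℕ→ℚ-suc (toℕ i)) ⟩
  (ℕ→ℚ m - (ℕ→ℚ (toℕ i) + 1ℚ)) + height s t                     ≡⟨ solve 3 (λ m i h → (m :- (i :+ con 1ℚ)) :+ h := m :- (i :+ (con 1ℚ :- h)))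
                                                                       refl (ℕ→ℚ m) (ℕ→ℚ (toℕ i)) (height s t) ⟩
  ℕ→ℚ m - (ℕ→ℚ (toℕ i) + (1ℚ - height s t))                    ≡⟨ cong₂ (λ z h → ℕ→ℚ m - (z + h))
                                                                       (sym (rowBase-opposite-opposite i)) (sym (height-negSign s t)) ⟩
  ℕ→ℚ m - (rowBase m (toℕ (F.opposite i)) + height (negSign s) t) ∎
  where open ≡-Reasoning

colMatrix-entry : ∀ {r} (v : Vec Sign r) q → lookup (lookup (colMatrix v) q) F.zero ≡ signEntry (lookup v (F.opposite q))
colMatrix-entry v q =
  cong (λ row → lookup row F.zero) (trans (lookup-reverse (map (λ s → signEntry s ∷ []) v) q) (Vec.lookup-map (F.opposite q) (λ s → signEntry s ∷ []) v))

columnHeight : ∀ {r} → Vec Sign r → Fin r → ℚ → ℚ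
columnHeight v s u = ℕ→ℚ (toℕ s) + height (lookup v s) u

record OnColumn {r} (v : Vec Sign r) (x y : ℚ) : Set where
  constructor onColumn
  field
    level : Fin r
    0≤x   : 0ℚ ≤ x
    x≤1   : x ≤ 1ℚ
    y≡    : y ≡ columnHeight v level x

fromColumnCell : ∀ {r} {v : Vec Sign r} {q j x y} → CellPoint (colMatrix v) q j x y → OnColumn v x y
fromColumnCell {v = v} {q} {F.zero} {x} (cellPoint t s 0≤t t≤1 x≡ entry≡ y≡)
  with refl ← signEntry-injective (trans (sym entry≡) (colMatrix-entry v q)) =
  onColumn (F.opposite q) (subst (0ℚ ≤_) (sym x≡t) 0≤t) (subst (_≤ 1ℚ) (sym x≡t) t≤1)
    (trans y≡ (cong₂ _+_ (rowBase-opposite q) (cong (height s) (sym x≡t))))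
  where
  x≡t : x ≡ t
  x≡t = trans x≡ (+-identityˡ t)

toColumnCell : ∀ {r} {v : Vec Sign r} {x y} (p : OnColumn v x y) →
               CellPoint (colMatrix v) (F.opposite (OnColumn.level p)) F.zero x y
toColumnCell {v = v} {x} (onColumn level 0≤x x≤1 y≡) = cellPoint x (lookup v level) 0≤x x≤1 (sym (+-identityˡ x))
  (trans (colMatrix-entry v (F.opposite level)) (cong (signEntry ∘ lookup v) (F.opposite-involutive level)))
  (trans y≡ (cong (_+ height (lookup v level) x) (sym (rowBase-opposite-opposite level))))

copyHeight : ℕ → Sign → ℕ → ℚ → ℚ
copyHeight m plus  s y = ℕ→ℚ s * ℕ→ℚ m + y
copyHeight m minus s y = ℕ→ℚ s * ℕ→ℚ m + (ℕ→ℚ m - y)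

stackHeight : ∀ {r} → Vec Sign r → ℕ → Fin r → ℚ → ℚ
stackHeight v m s y = copyHeight m (lookup v s) (toℕ s) y

complement-entry : ∀ {m k} (M : Matrix m k) i j →
  lookup (lookup (complement M) i) j ≡ negE (lookup (lookup M (F.opposite i)) j)
complement-entry M i j = begin
  lookup (lookup (map (map negE) (reverse M)) i) j ≡⟨ cong (λ row → lookup row j) (Vec.lookup-map i (map negE) (reverse M)) ⟩
  lookup (map negE (lookup (reverse M) i)) j       ≡⟨ cong (λ row → lookup (map negE row) j) (lookup-reverse M i) ⟩
  lookup (map negE (lookup M (F.opposite i))) j    ≡⟨ Vec.lookup-map j negE (lookup M (F.opposite i)) ⟩
  negE (lookup (lookup M (F.opposite i)) j)        ∎
  where open ≡-Reasoning

stackRow : ∀ {r m} → Fin r → Fin m → Fin (r ℕ.* m)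
stackRow s i = F.combine (F.opposite s) i

stackRow-surjective : ∀ {r m} (I : Fin (r ℕ.* m)) → ∃ λ s → ∃ λ i → stackRow s i ≡ I
stackRow-surjective {r} {m} I with q , i , refl ← F.combine-surjective {r} {m} I =
  F.opposite q , i , cong (λ q → F.combine q i) (F.opposite-involutive q)

stackMatrix-entry : ∀ {r m k} (v : Vec Sign r) (M : Matrix m k) s i j →
  lookup (lookup (stackMatrix v M) (stackRow s i)) j ≡ lookup (lookup (copyFor M (lookup v s)) i) j
stackMatrix-entry v M s i j = cong (λ row → lookup row j) (begin
  lookup (concat (reverse (map (copyFor M) v))) (F.combine (F.opposite s) i)
    ≡⟨ Vec.lookup-concat (reverse (map (copyFor M) v)) (F.opposite s) i ⟩
  lookup (lookup (reverse (map (copyFor M) v)) (F.opposite s)) i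
    ≡⟨ cong (λ N → lookup N i) (lookup-reverse-opposite (map (copyFor M) v) s) ⟩
  lookup (lookup (map (copyFor M) v) s) i
    ≡⟨ cong (λ N → lookup N i) (Vec.lookup-map s (copyFor M) v) ⟩
  lookup (copyFor M (lookup v s)) i
    ∎)
  where open ≡-Reasoning

stackMatrix-rowBase : ∀ {r m} (s : Fin r) (i : Fin m) →
  rowBase (r ℕ.* m) (toℕ (stackRow s i)) ≡ ℕ→ℚ (toℕ s) * ℕ→ℚ m + rowBase m (toℕ i)
stackMatrix-rowBase {r} {m} s i = begin
  ℕ→ℚ (r ℕ.* m) - ℕ→ℚ (suc (toℕ (stackRow s i)))  ≡⟨ cong₂ _-_ r*m≡ suc-stackRow≡ ⟩
  (O + (S + 1ℚ)) * M - (M * O + I + 1ℚ)            ≡⟨ solve 4 (λ O S I M → (O :+ (S :+ con 1ℚ)) :* M :- (M :* O :+ I :+ con 1ℚ)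
                                                             := S :* M :+ (M :- (I :+ con 1ℚ))) refl O S I M ⟩
  S * M + (M - (I + 1ℚ))                           ≡⟨ cong (λ z → S * M + (M - z)) (ℕ→ℚ-suc (toℕ i)) ⟨
  S * M + rowBase m (toℕ i)                        ∎
  where
  open ≡-Reasoning
  O S I M : ℚ
  O = ℕ→ℚ (toℕ (F.opposite s))
  S = ℕ→ℚ (toℕ s)
  I = ℕ→ℚ (toℕ i)
  M = ℕ→ℚ m
  r*m≡ : ℕ→ℚ (r ℕ.* m) ≡ (O + (S + 1ℚ)) * M
  r*m≡ = trans (ℕ→ℚ-homo-* r m) (cong (_* M) (trans (ℕ→ℚ-opposite s) (cong (λ z → O + z) (ℕ→ℚ-suc (toℕ s)))))
  suc-stackRow≡ : ℕ→ℚ (suc (toℕ (stackRow s i))) ≡ M * O + I + 1ℚ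
  suc-stackRow≡ = begin
    ℕ→ℚ (suc (toℕ (F.combine (F.opposite s) i)))    ≡⟨ cong (ℕ→ℚ ∘ suc) (F.toℕ-combine (F.opposite s) i) ⟩
    ℕ→ℚ (suc (m ℕ.* toℕ (F.opposite s) ℕ.+ toℕ i))  ≡⟨ ℕ→ℚ-suc (m ℕ.* toℕ (F.opposite s) ℕ.+ toℕ i) ⟩
    ℕ→ℚ (m ℕ.* toℕ (F.opposite s) ℕ.+ toℕ i) + 1ℚ   ≡⟨ cong (_+ 1ℚ) (ℕ→ℚ-homo-+ (m ℕ.* toℕ (F.opposite s)) (toℕ i)) ⟩
    ℕ→ℚ (m ℕ.* toℕ (F.opposite s)) + I + 1ℚ         ≡⟨ cong (λ z → z + I + 1ℚ) (ℕ→ℚ-homo-* m (toℕ (F.opposite s))) ⟩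
    M * O + I + 1ℚ                                  ∎

record CopyPoint {m k} (M : Matrix m k) (g : Sign) (s : ℕ) (j : Fin k) (t Y : ℚ) : Set where
  constructor copyPoint
  field
    row    : Fin m
    sign   : Sign
    entry≡ : lookup (lookup M row) j ≡ signEntry sign
    Y≡     : Y ≡ copyHeight m g s (rowBase m (toℕ row) + height sign t)

fromCopyCell : ∀ {m k} (M : Matrix m k) g s i j σ {t Y} → lookup (lookup (copyFor M g) i) j ≡ signEntry σ →
               Y ≡ ℕ→ℚ s * ℕ→ℚ m + (rowBase m (toℕ i) + height σ t) → CopyPoint M g s j t Y
fromCopyCell M plus  s i j σ entry≡ Y≡ = copyPoint i σ entry≡ Y≡
fromCopyCell {m} M minus s i j σ {t} entry≡ Y≡ = copyPoint (F.opposite i) (negSign σ)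
  (trans (sym (negE-involutive _)) (trans (cong negE (trans (sym (complement-entry M i j)) entry≡)) (negE-signEntry σ)))
  (trans Y≡ (cong (λ z → ℕ→ℚ s * ℕ→ℚ m + z) (reflect-height m i σ t)))

toCopyCell : ∀ {m k} (M : Matrix m k) g s i j σ t → lookup (lookup M i) j ≡ signEntry σ →
  Σ (Fin m) λ i′ → Σ Sign λ σ′ → lookup (lookup (copyFor M g) i′) j ≡ signEntry σ′ ×
    ℕ→ℚ s * ℕ→ℚ m + (rowBase m (toℕ i′) + height σ′ t) ≡ copyHeight m g s (rowBase m (toℕ i) + height σ t)
toCopyCell M plus  s i j σ t entry≡ = i , σ , entry≡ , refl
toCopyCell {m} M minus s i j σ t entry≡ = F.opposite i , negSign σ ,
  trans (complement-entry M (F.opposite i) j)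
    (trans (cong (λ i → negE (lookup (lookup M i) j)) (F.opposite-involutive i)) (trans (cong negE entry≡) (negE-signEntry σ))) ,
  cong (λ z → ℕ→ℚ s * ℕ→ℚ m + z) (begin
    X                        ≡⟨ solve 2 (λ m X → X := m :- (m :- X)) refl (ℕ→ℚ m) X ⟩
    ℕ→ℚ m - (ℕ→ℚ m - X)      ≡⟨ cong (λ z → ℕ→ℚ m - z) (reflect-height m i σ t) ⟨
    ℕ→ℚ m - (rowBase m (toℕ i) + height σ t) ∎)
  where
  open ≡-Reasoning
  X : ℚ
  X = rowBase m (toℕ (F.opposite i)) + height (negSign σ) t

record StackPoint {r m k} (v : Vec Sign r) (M : Matrix m k) (j : Fin k) (t Y : ℚ) : Set where
  constructor stackPoint
  field
    copy  : Fin r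
    point : CopyPoint M (lookup v copy) (toℕ copy) j t Y

opaque
  fromStackCell : ∀ {r m k} (v : Vec Sign r) (M : Matrix m k) {I j x Y} (p : CellPoint (stackMatrix v M) I j x Y) →
                  StackPoint v M j (CellPoint.t p) Y
  fromStackCell {r} {m} v M {I} {j} (cellPoint t σ _ _ _ entry≡ Y≡) with s , i , refl ← stackRow-surjective {r} {m} I =
    stackPoint s (fromCopyCell M (lookup v s) (toℕ s) i j σ (trans (sym (stackMatrix-entry v M s i j)) entry≡)
      (trans Y≡ (trans (cong (_+ height σ t) (stackMatrix-rowBase s i))
                       (+-assoc (ℕ→ℚ (toℕ s) * ℕ→ℚ m) (rowBase m (toℕ i)) (height σ t)))))

opaque
  toStackCell : ∀ {r m k} (v : Vec Sign r) {M : Matrix m k} (s : Fin r) {i j x y} → CellPoint M i j x y →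
    Σ (Fin (r ℕ.* m)) λ I → CellPoint (stackMatrix v M) I j x (stackHeight v m s y)
  toStackCell {r} {m} v {M} s {i} {j} {y = y} (cellPoint t σ 0≤t t≤1 x≡ entry≡ y≡)
    with i′ , σ′ , copy-entry≡ , Y≡ ← toCopyCell M (lookup v s) (toℕ s) i j σ t entry≡ =
    stackRow s i′ , cellPoint t σ′ 0≤t t≤1 x≡ (trans (stackMatrix-entry v M s i′ j) copy-entry≡) (begin
      copyHeight m (lookup v s) (toℕ s) y                           ≡⟨ cong (copyHeight m (lookup v s) (toℕ s)) y≡ ⟩
      copyHeight m (lookup v s) (toℕ s) (rowBase m (toℕ i) + height σ t) ≡⟨ Y≡ ⟨
      ℕ→ℚ (toℕ s) * ℕ→ℚ m + (rowBase m (toℕ i′) + height σ′ t)     ≡⟨ +-assoc (ℕ→ℚ (toℕ s) * ℕ→ℚ m) (rowBase m (toℕ i′)) (height σ′ t) ⟨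
      ℕ→ℚ (toℕ s) * ℕ→ℚ m + rowBase m (toℕ i′) + height σ′ t       ≡⟨ cong (_+ height σ′ t) (stackMatrix-rowBase s i′) ⟨
      rowBase (r ℕ.* m) (toℕ (stackRow s i′)) + height σ′ t         ∎)
    where open ≡-Reasoning

-- Comparing heights across the stack

strictMono-<⇔ : ∀ {n} (f : Fin n → ℚ) → (∀ a b → a F.< b → f a < f b) → ∀ a b → (f a < f b) ⇔ (a F.< b)
strictMono-<⇔ f f-mono a b = mk⇔ reflect (f-mono a b)
  where
  reflect : f a < f b → a F.< b
  reflect fa<fb with F.<-cmp a b
  ... | tri< a<b _ _ = a<b
  ... | tri≈ _ refl _ = ⊥-elim (<-irrefl refl fa<fb)
  ... | tri> _ _ b<a = ⊥-elim (<-asym fa<fb (f-mono b a b<a))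

+-<⇔ : ∀ r {p q} → (r + p < r + q) ⇔ (p < q)
+-<⇔ r = mk⇔ (+-cancelˡ-< r) (+-monoʳ-< r)

+[c-]-<⇔ : ∀ r c {p q} → (r + (c - p) < r + (c - q)) ⇔ (q < p)
+[c-]-<⇔ r c {p} {q} = mk⇔
  (λ lt → neg-cancel-< (+-cancelˡ-< c (+-cancelˡ-< r lt)))
  (λ q<p → +-monoʳ-< r (+-monoʳ-< c (neg-antimono-< q<p)))
  where
  neg-cancel-< : - p < - q → q < p
  neg-cancel-< lt = subst₂ _<_ (neg-involutive q) (neg-involutive p) (neg-antimono-< lt)

ℕ→ℚ-suc-* : ∀ s m → ℕ→ℚ (suc s) * ℕ→ℚ m ≡ ℕ→ℚ s * ℕ→ℚ m + ℕ→ℚ m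
ℕ→ℚ-suc-* s m = trans (cong (_* ℕ→ℚ m) (ℕ→ℚ-suc s)) (solve 2 (λ s m → (s :+ con 1ℚ) :* m := s :* m :+ m) refl (ℕ→ℚ s) (ℕ→ℚ m))

copyHeight-lower : ∀ m g s {y} → 0ℚ < y → y < ℕ→ℚ m → ℕ→ℚ s * ℕ→ℚ m < copyHeight m g s y
copyHeight-lower m plus  s 0<y _   = gap⇒< _ refl 0<y
copyHeight-lower m minus s _   y<m = gap⇒< _ refl (p<q⇒0<q-p y<m)

m-y<m : ∀ {m y} → 0ℚ < y → m - y < m
m-y<m {m} {y} 0<y = gap⇒< y (solve 2 (λ m y → m := (m :- y) :+ y) refl m y) 0<y

copyHeight-upper : ∀ m g s {y} → 0ℚ < y → y < ℕ→ℚ m → copyHeight m g s y < ℕ→ℚ (suc s) * ℕ→ℚ m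
copyHeight-upper m plus  s {y} _   y<m = subst (copyHeight m plus s y <_) (sym (ℕ→ℚ-suc-* s m)) (+-monoʳ-< (ℕ→ℚ s * ℕ→ℚ m) y<m)
copyHeight-upper m minus s {y} 0<y _   = subst (copyHeight m minus s y <_) (sym (ℕ→ℚ-suc-* s m)) (+-monoʳ-< (ℕ→ℚ s * ℕ→ℚ m) (m-y<m {ℕ→ℚ m} 0<y))

copyHeight-level-< : ∀ m g g′ {s s′ y y′} → s ℕ.< s′ → 0ℚ < y → y < ℕ→ℚ m → 0ℚ < y′ → y′ < ℕ→ℚ m →
                     copyHeight m g s y < copyHeight m g′ s′ y′
copyHeight-level-< m g g′ {s} {s′} s<s′ 0<y y<m 0<y′ y′<m = <-trans (copyHeight-upper m g s 0<y y<m)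
  (≤-<-trans (subst₂ _≤_ (ℕ→ℚ-homo-* (suc s) m) (ℕ→ℚ-homo-* s′ m) (ℕ→ℚ-mono-≤ (ℕ.*-monoˡ-≤ m s<s′)))
             (copyHeight-lower m g′ s′ 0<y′ y′<m))

copyHeight-injective : ∀ m g s {y y′} → copyHeight m g s y ≡ copyHeight m g s y′ → y ≡ y′
copyHeight-injective m plus  s e = +-cancelˡ-≡ (ℕ→ℚ s * ℕ→ℚ m) e
copyHeight-injective m minus s {y} {y′} e =
  trans (sym (m-[m-y]≡y y)) (trans (cong (λ z → ℕ→ℚ m - z) (+-cancelˡ-≡ (ℕ→ℚ s * ℕ→ℚ m) e)) (m-[m-y]≡y y′))
  where
  m-[m-y]≡y : ∀ y → ℕ→ℚ m - (ℕ→ℚ m - y) ≡ y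
  m-[m-y]≡y = solve 2 (λ m y → m :- (m :- y) := y) refl (ℕ→ℚ m)

copyHeight-<⇔ : ∀ m g s {u u′ y y′} → ((u < u′) ⇔ (y < y′)) → ((u′ < u) ⇔ (y′ < y)) →
                (ℕ→ℚ s + height g u < ℕ→ℚ s + height g u′) ⇔ (copyHeight m g s y < copyHeight m g s y′)
copyHeight-<⇔ m plus  s u<u′⇔y<y′ _ =
  ⇔.trans (+-<⇔ (ℕ→ℚ s)) (⇔.trans u<u′⇔y<y′ (⇔.sym (+-<⇔ (ℕ→ℚ s * ℕ→ℚ m))))
copyHeight-<⇔ m minus s _ u′<u⇔y′<y =
  ⇔.trans (+[c-]-<⇔ (ℕ→ℚ s) 1ℚ) (⇔.trans u′<u⇔y′<y (⇔.sym (+[c-]-<⇔ (ℕ→ℚ s * ℕ→ℚ m) (ℕ→ℚ m))))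

columnHeight-level-≤ : ∀ {r} (v : Vec Sign r) {s s′ : Fin r} {u u′} → toℕ s ℕ.< toℕ s′ →
  0ℚ ≤ u × u ≤ 1ℚ → 0ℚ ≤ u′ × u′ ≤ 1ℚ → columnHeight v s u ≤ columnHeight v s′ u′
columnHeight-level-≤ v {s} {s′} {u} {u′} s<s′ (0≤u , u≤1) (0≤u′ , u′≤1) = begin
  ℕ→ℚ (toℕ s) + height (lookup v s) u  ≤⟨ +-monoʳ-≤ (ℕ→ℚ (toℕ s)) (height≤1 (lookup v s) 0≤u u≤1) ⟩
  ℕ→ℚ (toℕ s) + 1ℚ                     ≤⟨ ℕ→ℚ-<⇒+1≤ s<s′ ⟩
  ℕ→ℚ (toℕ s′)                         ≤⟨ gap⇒≤ _ refl (0≤height (lookup v s′) 0≤u′ u′≤1) ⟩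
  ℕ→ℚ (toℕ s′) + height (lookup v s′) u′ ∎
  where open ≤-Reasoning

columnHeight-<⇔stackHeight-< : ∀ {r} (v : Vec Sign r) m (s s′ : Fin r) {u u′ y y′} →
  0ℚ ≤ u × u ≤ 1ℚ → 0ℚ ≤ u′ × u′ ≤ 1ℚ → 0ℚ < y × y < ℕ→ℚ m → 0ℚ < y′ × y′ < ℕ→ℚ m →
  (columnHeight v s u ≡ columnHeight v s′ u′ → s ≡ s′) → ((u < u′) ⇔ (y < y′)) → ((u′ < u) ⇔ (y′ < y)) →
  (columnHeight v s u < columnHeight v s′ u′) ⇔
  (stackHeight v m s y < stackHeight v m s′ y′)
columnHeight-<⇔stackHeight-< v m s s′ u∈ u′∈ (0<y , y<m) (0<y′ , y′<m) same-level u<u′⇔y<y′ u′<u⇔y′<y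
  with F.<-cmp s s′
... | tri< s<s′ _ _ = mk⇔
  (λ _ → copyHeight-level-< m (lookup v s) (lookup v s′) s<s′ 0<y y<m 0<y′ y′<m)
  (λ _ → ≤∧≢⇒< (columnHeight-level-≤ v s<s′ u∈ u′∈) (λ e → F.<-irrefl (same-level e) s<s′))
... | tri≈ _ refl _ = copyHeight-<⇔ m (lookup v s) (toℕ s) u<u′⇔y<y′ u′<u⇔y′<y
... | tri> _ _ s′<s = mk⇔
  (λ lt → ⊥-elim (<-asym lt (≤∧≢⇒< (columnHeight-level-≤ v s′<s u′∈ u∈) (λ e → F.<-irrefl (sym (same-level (sym e))) s′<s))))
  (λ lt → ⊥-elim (<-asym lt (copyHeight-level-< m (lookup v s′) (lookup v s) s′<s 0<y′ y′<m 0<y y<m)))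

stackHeight-injective : ∀ {r} (v : Vec Sign r) m (s s′ : Fin r) {y y′} →
  0ℚ < y × y < ℕ→ℚ m → 0ℚ < y′ × y′ < ℕ→ℚ m →
  stackHeight v m s y ≡ stackHeight v m s′ y′ → y ≡ y′
stackHeight-injective v m s s′ (0<y , y<m) (0<y′ , y′<m) e with F.<-cmp s s′
... | tri< s<s′ _ _ = ⊥-elim (<-irrefl e (copyHeight-level-< m (lookup v s) (lookup v s′) s<s′ 0<y y<m 0<y′ y′<m))
... | tri≈ _ refl _ = copyHeight-injective m (lookup v s) (toℕ s) e
... | tri> _ _ s′<s = ⊥-elim (<-irrefl (sym e) (copyHeight-level-< m (lookup v s′) (lookup v s) s′<s 0<y′ y′<m 0<y y<m))

0≤rowBase : ∀ m (i : Fin m) → 0ℚ ≤ rowBase m (toℕ i)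
0≤rowBase m i = p≤q⇒0≤q-p (ℕ→ℚ-mono-≤ (F.toℕ<n i))

rowBase+1≤m : ∀ m (i : Fin m) → rowBase m (toℕ i) + 1ℚ ≤ ℕ→ℚ m
rowBase+1≤m m i = gap⇒≤ (ℕ→ℚ (toℕ i))
  (trans (solve 2 (λ m i → m := (m :- (i :+ con 1ℚ)) :+ con 1ℚ :+ i) refl (ℕ→ℚ m) (ℕ→ℚ (toℕ i)))
         (cong (λ z → (ℕ→ℚ m - z) + 1ℚ + ℕ→ℚ (toℕ i)) (sym (ℕ→ℚ-suc (toℕ i)))))
  (ℕ→ℚ-nonNeg (toℕ i))

cellHeight-∈ : ∀ m (i : Fin m) {h} → 0ℚ ≤ h → h ≤ 1ℚ →
               0ℚ ≤ rowBase m (toℕ i) + h × rowBase m (toℕ i) + h ≤ ℕ→ℚ m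
cellHeight-∈ m i 0≤h h≤1 = +-mono-≤ (0≤rowBase m i) 0≤h , ≤-trans (+-monoʳ-≤ (rowBase m (toℕ i)) h≤1) (rowBase+1≤m m i)

cellHeight-∈-strict : ∀ m (i : Fin m) {h} → 0ℚ < h → h < 1ℚ →
                      0ℚ < rowBase m (toℕ i) + h × rowBase m (toℕ i) + h < ℕ→ℚ m
cellHeight-∈-strict m i 0<h h<1 =
  +-mono-≤-< (0≤rowBase m i) 0<h , <-≤-trans (+-monoʳ-< (rowBase m (toℕ i)) h<1) (rowBase+1≤m m i)

-- From products to the stacked grid

module ProductToStack {r m k} (v : Vec Sign r) (M : Matrix m k) {n} (τ π σ : Permutation′ n)
  (π∈ : InGrid (colMatrix v) n π) (σ∈ : InGrid M n σ) (τ≡πσ : ∀ a → τ ⟨$⟩ʳ a ≡ π ⟨$⟩ʳ (σ ⟨$⟩ʳ a)) where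

  P : Placement (colMatrix v) n π
  P = fromInGrid {M = colMatrix v} π∈

  Q-generic : Σ (Placement M n σ) GeneralPosition
  Q-generic = toGeneralPosition (fromInGrid {M = M} σ∈)

  Q : Placement M n σ
  Q = proj₁ Q-generic

  module P = Placement P
  module Q = Placement Q
  open GeneralPosition (proj₂ Q-generic)

  column : ∀ c → OnColumn v (P.x c) (P.y c)
  column c = fromColumnCell (P.onCell c)

  level : Fin n → Fin r
  level a = OnColumn.level (column (σ ⟨$⟩ʳ a))

  u : Fin n → ℚ
  u a = P.x (σ ⟨$⟩ʳ a)

  -- Point a keeps its height inside M and moves into the band of the column point σ(a).
  Y : Fin n → ℚ
  Y a = stackHeight v m (level a) (Q.y a)

  u∈ : ∀ a → 0ℚ ≤ u a × u a ≤ 1ℚ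
  u∈ a = OnColumn.0≤x (column (σ ⟨$⟩ʳ a)) , OnColumn.x≤1 (column (σ ⟨$⟩ʳ a))

  Q-y∈ : ∀ a → 0ℚ < Q.y a × Q.y a < ℕ→ℚ m
  Q-y∈ a = subst (λ y → 0ℚ < y × y < ℕ→ℚ m) (sym (CellPoint.y≡ (Q.onCell a)))
    (cellHeight-∈-strict m (Q.row a) (0<height (Q.sign a) (0<t a) (t<1 a)) (height<1 (Q.sign a) (0<t a) (t<1 a)))

  stackCell : ∀ a → Σ (Fin (r ℕ.* m)) λ I → CellPoint (stackMatrix v M) I (Q.col a) (Q.x a) (Y a)
  stackCell a = toStackCell v (level a) (Q.onCell a)

  Y-injective : ∀ a b → Y a ≡ Y b → a ≡ b
  Y-injective a b e = Q.y-injective a b (stackHeight-injective v m (level a) (level b) (Q-y∈ a) (Q-y∈ b) e)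

  P-y≡ : ∀ a → P.y (σ ⟨$⟩ʳ a) ≡ columnHeight v (level a) (u a)
  P-y≡ a = OnColumn.y≡ (column (σ ⟨$⟩ʳ a))

  u-<⇔ : ∀ a b → (u a < u b) ⇔ (Q.y a < Q.y b)
  u-<⇔ a b = ⇔.trans (strictMono-<⇔ P.x P.x-increasing (σ ⟨$⟩ʳ a) (σ ⟨$⟩ʳ b)) (Q.y-order a b)

  same-level : ∀ a b → columnHeight v (level a) (u a) ≡ columnHeight v (level b) (u b) → level a ≡ level b
  same-level a b e = cong (OnColumn.level ∘ column) (P.y-injective _ _ (trans (P-y≡ a) (trans e (sym (P-y≡ b)))))

  P-y-<⇔Y-< : ∀ a b → (P.y (σ ⟨$⟩ʳ a) < P.y (σ ⟨$⟩ʳ b)) ⇔ (Y a < Y b)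
  P-y-<⇔Y-< a b = subst₂ (λ p q → (p < q) ⇔ (Y a < Y b)) (sym (P-y≡ a)) (sym (P-y≡ b))
    (columnHeight-<⇔stackHeight-< v m (level a) (level b) (u∈ a) (u∈ b) (Q-y∈ a) (Q-y∈ b)
      (same-level a b) (u-<⇔ a b) (u-<⇔ b a))

  τ-order : ∀ a b → (τ ⟨$⟩ʳ a F.< τ ⟨$⟩ʳ b) ⇔ (Y a < Y b)
  τ-order a b = subst₂ (λ p q → (p F.< q) ⇔ (Y a < Y b)) (sym (τ≡πσ a)) (sym (τ≡πσ b))
    (⇔.trans (P.y-order (σ ⟨$⟩ʳ a) (σ ⟨$⟩ʳ b)) (P-y-<⇔Y-< a b))

  placement : Placement (stackMatrix v M) n τ
  placement = record
    { x = Q.x ; y = Y ; row = proj₁ ∘ stackCell ; col = Q.col ; onCell = proj₂ ∘ stackCell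
    ; x-increasing = Q.x-increasing ; y-injective = Y-injective ; y-order = τ-order }

product⊆stack : ∀ {r m k} (v : Vec Sign r) (M : Matrix m k) n τ → SetProduct (𝒢ᵛ v) (𝒢 M) n τ → 𝒢 (stackMatrix v M) n τ
product⊆stack v M n τ (π , σ , π∈ , σ∈ , τ≡πσ) = toInGrid (ProductToStack.placement v M τ π σ π∈ σ∈ τ≡πσ)

-- From the stacked grid to products

ℕ→ℚ-suc*unitFraction : ∀ m → ℕ→ℚ (suc m) * unitFraction m ≡ 1ℚ
ℕ→ℚ-suc*unitFraction m = trans (cong (_* unitFraction m) (ℕ→ℚ-≡-mkℚ (suc m)))
  (*-inverseʳ (mkℚ (+ suc m) 0 (Coprimality.sym (1-coprimeTo (suc m)))))

y*unitFraction*suc : ∀ m y → y * unitFraction m * ℕ→ℚ (suc m) ≡ y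
y*unitFraction*suc m y = begin
  y * unitFraction m * ℕ→ℚ (suc m)    ≡⟨ *-assoc y (unitFraction m) (ℕ→ℚ (suc m)) ⟩
  y * (unitFraction m * ℕ→ℚ (suc m))  ≡⟨ cong (y *_) (trans (*-comm (unitFraction m) (ℕ→ℚ (suc m))) (ℕ→ℚ-suc*unitFraction m)) ⟩
  y * 1ℚ                              ≡⟨ *-identityʳ y ⟩
  y                                   ∎
  where open ≡-Reasoning

height-rescaled : ∀ m g s y →
  (ℕ→ℚ s + height g (y * unitFraction m)) * ℕ→ℚ (suc m) ≡ copyHeight (suc m) g s y
height-rescaled m plus s y =
  trans (*-distribʳ-+ (ℕ→ℚ (suc m)) (ℕ→ℚ s) (y * unitFraction m))
        (cong (λ z → ℕ→ℚ s * ℕ→ℚ (suc m) + z) (y*unitFraction*suc m y))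
height-rescaled m minus s y =
  trans (solve 3 (λ S w M → (S :+ (con 1ℚ :- w)) :* M := S :* M :+ (M :- w :* M)) refl (ℕ→ℚ s) (y * unitFraction m) (ℕ→ℚ (suc m)))
        (cong (λ z → ℕ→ℚ s * ℕ→ℚ (suc m) + (ℕ→ℚ (suc m) - z)) (y*unitFraction*suc m y))

module StackToProduct {r m k} (v : Vec Sign r) (M : Matrix (suc m) k) {n} (τ : Permutation′ n)
  (τ∈ : InGrid (stackMatrix v M) n τ) where

  S-generic : Σ (Placement (stackMatrix v M) n τ) GeneralPosition
  S-generic = toGeneralPosition (fromInGrid {M = stackMatrix v M} τ∈)

  S : Placement (stackMatrix v M) n τ
  S = proj₁ S-generic

  module S = Placement S
  open GeneralPosition (proj₂ S-generic)

  unstacked : ∀ a → StackPoint v M (S.col a) (S.t a) (S.y a)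
  unstacked a = fromStackCell v M (S.onCell a)

  level : Fin n → Fin r
  level a = StackPoint.copy (unstacked a)

  point : ∀ a → CopyPoint M (lookup v (level a)) (toℕ (level a)) (S.col a) (S.t a) (S.y a)
  point a = StackPoint.point (unstacked a)

  row : Fin n → Fin (suc m)
  row a = CopyPoint.row (point a)

  sign : Fin n → Sign
  sign a = CopyPoint.sign (point a)

  yM : Fin n → ℚ
  yM a = rowBase (suc m) (toℕ (row a)) + height (sign a) (S.t a)

  yM-injective : ∀ a b → yM a ≡ yM b → a ≡ b
  yM-injective a b e = height-injective (sign a) (sign b) a b
    (unitSpaced-≡ (rowBase-unitSpaced (suc m) (toℕ (row a)) (toℕ (row b)))
      (<⇒≤ (0<height (sign a) (0<t a) (t<1 a))) (height<1 (sign a) (0<t a) (t<1 a))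
      (<⇒≤ (0<height (sign b) (0<t b) (t<1 b))) (height<1 (sign b) (0<t b) (t<1 b)) e)

  open Ranking yM yM-injective using (rankPermutation; rankPermutation-<⇔)

  σ : Permutation′ n
  σ = rankPermutation

  Q : Placement M n σ
  Q = record
    { x = S.x ; y = yM ; row = row ; col = S.col
    ; onCell = λ a → cellPoint (S.t a) (sign a) (CellPoint.0≤t (S.onCell a)) (CellPoint.t≤1 (S.onCell a))
                               (CellPoint.x≡ (S.onCell a)) (CopyPoint.entry≡ (point a)) refl
    ; x-increasing = S.x-increasing ; y-injective = yM-injective ; y-order = rankPermutation-<⇔ }

  π : Permutation′ n
  π = flip σ ∘ₚ τ

  τ≡πσ : ∀ a → τ ⟨$⟩ʳ a ≡ π ⟨$⟩ʳ (σ ⟨$⟩ʳ a)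
  τ≡πσ a = cong (τ ⟨$⟩ʳ_) (sym (inverseˡ σ))

  unrank : Fin n → Fin n
  unrank c = σ ⟨$⟩ˡ c

  -- Column abscissae are the heights inside M scaled by 1/m, so that by height-rescaled
  -- the column heights, scaled back by m, are the stacked heights.
  u : Fin n → ℚ
  u c = yM (unrank c) * unitFraction m

  yM∈ : ∀ a → 0ℚ ≤ yM a × yM a ≤ ℕ→ℚ (suc m)
  yM∈ a = cellHeight-∈ (suc m) (row a) (0≤height (sign a) 0≤t t≤1) (height≤1 (sign a) 0≤t t≤1)
    where open CellPoint (S.onCell a) using (0≤t; t≤1)

  u∈ : ∀ c → 0ℚ ≤ u c × u c ≤ 1ℚ
  u∈ c = *-nonNeg (proj₁ (yM∈ (unrank c))) (<⇒≤ (unitFraction-pos m)) ,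
         subst (u c ≤_) (ℕ→ℚ-suc*unitFraction m)
           (*-monoʳ-≤-nonNeg (unitFraction m) {{nonNegative (<⇒≤ (unitFraction-pos m))}} (proj₂ (yM∈ (unrank c))))

  y′ : Fin n → ℚ
  y′ c = columnHeight v (level (unrank c)) (u c)

  y′-rescaled : ∀ c → y′ c * ℕ→ℚ (suc m) ≡ S.y (unrank c)
  y′-rescaled c = trans (height-rescaled m (lookup v (level a)) (toℕ (level a)) (yM a)) (sym (CopyPoint.Y≡ (point a)))
    where
    a : Fin n
    a = unrank c

  unrank-<⇔ : ∀ c d → (c F.< d) ⇔ (yM (unrank c) < yM (unrank d))
  unrank-<⇔ c d = subst₂ (λ c′ d′ → (c′ F.< d′) ⇔ (yM (unrank c) < yM (unrank d))) (inverseʳ σ) (inverseʳ σ)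
    (rankPermutation-<⇔ (unrank c) (unrank d))

  u-increasing : ∀ c d → c F.< d → u c < u d
  u-increasing c d c<d =
    *-monoˡ-<-pos (unitFraction m) {{positive (unitFraction-pos m)}} (Equivalence.to (unrank-<⇔ c d) c<d)

  y′-injective : ∀ c d → y′ c ≡ y′ d → c ≡ d
  y′-injective c d e = begin
    c                        ≡⟨ inverseʳ σ ⟨
    σ ⟨$⟩ʳ (unrank c)        ≡⟨ cong (σ ⟨$⟩ʳ_) (S.y-injective (unrank c) (unrank d) S-y≡) ⟩
    σ ⟨$⟩ʳ (unrank d)        ≡⟨ inverseʳ σ ⟩
    d                        ∎
    where
    open ≡-Reasoning
    S-y≡ : S.y (unrank c) ≡ S.y (unrank d)
    S-y≡ = trans (sym (y′-rescaled c)) (trans (cong (_* ℕ→ℚ (suc m)) e) (y′-rescaled d))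

  y′-order : ∀ c d → (π ⟨$⟩ʳ c F.< π ⟨$⟩ʳ d) ⇔ (y′ c < y′ d)
  y′-order c d = ⇔.trans (S.y-order (unrank c) (unrank d))
    (subst₂ (λ p q → (p < q) ⇔ (y′ c < y′ d)) (y′-rescaled c) (y′-rescaled d)
      (mk⇔ (*-cancelʳ-<-nonNeg (ℕ→ℚ (suc m)) {{nonNegative (ℕ→ℚ-nonNeg (suc m))}})
           (*-monoˡ-<-pos (ℕ→ℚ (suc m)) {{positive (ℕ→ℚ-pos m)}})))

  P : Placement (colMatrix v) n π
  P = record
    { x = u ; y = y′ ; row = F.opposite ∘ level ∘ unrank ; col = λ _ → F.zero
    ; onCell = λ c → toColumnCell {v = v} (onColumn (level (unrank c)) (proj₁ (u∈ c)) (proj₂ (u∈ c)) refl)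
    ; x-increasing = u-increasing ; y-injective = y′-injective ; y-order = y′-order }

emptyInGrid : ∀ {m k} (M : Matrix m k) (π : Permutation′ 0) → InGrid M 0 π
emptyInGrid M π = (λ ()) , (λ ()) , (λ ()) , (λ ()) , (λ ()) , (λ ())

stack⊆product : ∀ {r m k} (v : Vec Sign r) (M : Matrix m k) n τ → 𝒢 (stackMatrix v M) n τ → SetProduct (𝒢ᵛ v) (𝒢 M) n τ
stack⊆product {m = suc m} v M n τ τ∈ = π , σ , toInGrid P , toInGrid Q , τ≡πσ
  where open StackToProduct v M τ τ∈
stack⊆product {m = zero} v M zero τ _ = τ , τ , emptyInGrid (colMatrix v) τ , emptyInGrid M τ , λ ()
stack⊆product {r} {zero} v M (suc n) τ (_ , _ , onGrid , _) with () ← subst Fin (ℕ.*-zeroʳ r) (proj₁ (onGrid F.zero))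

proposition9p1 : ∀ {r m k} (v : Vec Sign r) (M : Matrix m k) →
    SetProduct (𝒢ᵛ v) (𝒢 M) ≐ 𝒢 (stackMatrix v M)
proposition9p1 v M n τ = mk⇔ (product⊆stack v M n τ) (stack⊆product v M n τ)
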